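{- For a finite simple chordal outerplanar graph $G$ with maximum degree $\Delta \in \{2,3\}$, we have $\omega(G^2) = \chi(G^2) = \mathrm{ind}(G^2) + 1 = \Delta + 1$.
   Context: $G^2$ is the graph on $V(G)$ in which two distinct vertices are adjacent iff their distance in $G$ is 1 or 2; $\omega$ is the clique number, $\chi$ the chromatic number, and $\mathrm{ind}(H) = \max\{\delta(H') : H' \text{ an induced subgraph of } H\}$ the inductiveness, $\delta$ denoting minimum degree. -}

module Defs where

open import Data.Nat using (ℕ; zero; suc; _+_; _≤_; _%_)
open import Data.Fin using (Fin; toℕ; _≟_) renaming (_<_ to _<ᶠ_)
open import Data.Fin.Subset using (Subset; _∈_)
open import Data.Bool using (Bool; true; false; if_then_else_; _∧_; _∨_; not)
open import Data.List using (List; map; allFin)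
open import Data.Nat.ListAction using (sum)
open import Data.Bool.ListAction using (any)
open import Data.Product using (Σ; _×_; ∃; ∃-syntax)
open import Relation.Nullary using (¬_; does)
open import Relation.Binary.PropositionalEquality using (_≡_; _≢_)
open import Function.Definitions using (Injective)
open import Data.Vec using (lookup)

record SimpleGraph (n : ℕ) : Set where
  field
    E      : Fin n → Fin n → Bool
    sym    : ∀ u v → E u v ≡ E v u
    irrefl : ∀ v → E v v ≡ false

open SimpleGraph public

BRel : ℕ → Set
BRel n = Fin n → Fin n → Bool

Adj : ∀ {n} → BRel n → Fin n → Fin n → Set
Adj R u v = R u v ≡ true

deg : ∀ {n} → BRel n → Fin n → ℕ
deg {n} R v = sum (map (λ u → if R v u then 1 else 0) (allFin n))

degIn : ∀ {n} → BRel n → Subset n → Fin n → ℕ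
degIn {n} R S v = sum (map (λ u → if R v u ∧ lookup S u then 1 else 0) (allFin n))

MaxDegreeIs : ∀ {n} → BRel n → ℕ → Set
MaxDegreeIs R Δ = (∃[ v ] deg R v ≡ Δ) × (∀ v → deg R v ≤ Δ)

square : ∀ {n} → SimpleGraph n → BRel n
square {n} G u v =
  not (does (u ≟ v)) ∧ (E G u v ∨ any (λ w → E G u w ∧ E G w v) (allFin n))

CycNext : (m : ℕ) → Fin (4 + m) → Fin (4 + m) → Set
CycNext m i j = toℕ j ≡ suc (toℕ i) % (4 + m)

IsCycle : ∀ {n} → SimpleGraph n → (m : ℕ) → (Fin (4 + m) → Fin n) → Set
IsCycle G m c = Injective _≡_ _≡_ c × (∀ i j → CycNext m i j → Adj (E G) (c i) (c j))

Chordal : ∀ {n} → SimpleGraph n → Set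
Chordal {n} G = ∀ (m : ℕ) (c : Fin (4 + m) → Fin n) → IsCycle G m c →
  ∃[ i ] ∃[ j ] (Adj (E G) (c i) (c j) × ¬ CycNext m i j × ¬ CycNext m j i)

-- Outerplanar: the vertices can be placed in a cyclic order (on a circle,
-- i.e. on the outer face) such that no two edges cross.
Outerplanar : ∀ {n} → SimpleGraph n → Set
Outerplanar {n} G = ∃[ σ ] (Injective _≡_ _≡_ σ ×
  (∀ (i j k l : Fin n) → i <ᶠ j → j <ᶠ k → k <ᶠ l →
     Adj (E G) (σ i) (σ k) → Adj (E G) (σ j) (σ l) → Data.Empty.⊥))
  where import Data.Empty

IsClique : ∀ {n} → BRel n → (k : ℕ) → (Fin k → Fin n) → Set
IsClique R k f = Injective _≡_ _≡_ f × (∀ i j → i ≢ j → Adj R (f i) (f j))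

CliqueNumberIs : ∀ {n} → BRel n → ℕ → Set
CliqueNumberIs R k = (Σ _ (IsClique R k)) × (∀ m (f : Fin m → Fin _) → IsClique R m f → m ≤ k)

IsColouring : ∀ {n} → BRel n → (k : ℕ) → (Fin n → Fin k) → Set
IsColouring R k c = ∀ u v → Adj R u v → c u ≢ c v

ChromaticNumberIs : ∀ {n} → BRel n → ℕ → Set
ChromaticNumberIs {n} R k = (Σ _ (IsColouring R k)) × (∀ m (c : Fin n → Fin m) → IsColouring R m c → k ≤ m)

MinDegreeInIs : ∀ {n} → BRel n → Subset n → ℕ → Set
MinDegreeInIs R S d = (∃[ v ] (v ∈ S × degIn R S v ≡ d)) × (∀ v → v ∈ S → d ≤ degIn R S v)

InductivenessIs : ∀ {n} → BRel n → ℕ → Set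
InductivenessIs {n} R d = (∃[ S ] MinDegreeInIs R S d) × (∀ S e → MinDegreeInIs R S e → e ≤ d)

{-# OPTIONS --safe #-}
-- Number the vertices along the outer face, so that no two edges cross.  The key lemma
-- (good-exists) says that every induced subgraph G[A] has a simplicial vertex x with at most
-- Δ vertices of A within distance 2 of x in G[A].  Such an x is found at an endpoint of an
-- edge whose span contains no vertex of A, or exactly one, forming a triangle with the edge:
-- take an innermost edge a b whose span is not of this kind and walk from a, always to the
-- largest neighbour.  The walk either gets stuck at such an endpoint or reaches b, closing a
-- triangle (then an ear of it is good, which is where Δ ≤ 3 enters) or a longer chordless
-- cycle, which chordality forbids.  Since x is simplicial, deleting it from A keeps every
-- other pair at distance ≤ 2, so peeling good vertices shows that every nonempty S has a
-- vertex with at most Δ G²-neighbours in S.  Thus G² is Δ-degenerate, which bounds its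
-- inductiveness by Δ and its chromatic number by Δ + 1, while a vertex of degree Δ together
-- with its neighbours is a clique of size Δ + 1 in G².
module Submission where

open import Defs hiding (sym)
open import Data.Bool using (Bool; true; false; if_then_else_; _∧_; not)
open import Data.Bool.ListAction using (any)
open import Data.Bool.Properties using () renaming (_≟_ to _≟ᵇ_)
open import Data.Empty using (⊥; ⊥-elim)
open import Data.Fin using (Fin; zero; suc; _≟_; toℕ; _<_; _≤_; _<?_; _≤?_; punchOut)
open import Data.Fin.Properties
  using (any?; all?; toℕ-injective; toℕ<n; <-cmp; <-trans; ≤∧≢⇒<; injective⇒≤; punchOut-injective)
open import Data.Fin.Subset using (Subset)
open import Data.List using (List; []; _∷_; _++_; map; filter; length; allFin; lookup)
open import Data.List.Properties using (length-++-sucʳ; length-map; length-tabulate)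
open import Data.List.Membership.Propositional using (_∈_; _∉_)
open import Data.List.Membership.Propositional.Properties
  using (∈-∃++; ∈-++⁻; ∈-++⁺ˡ; ∈-++⁺ʳ; ∈-filter⁺; ∈-filter⁻; ∈-allFin; ∈-map⁺; ∈-map⁻; ∈-lookup)
open import Data.List.Relation.Binary.Subset.Propositional using (_⊆_)
open import Data.List.Relation.Unary.Any as Any using (here; there)
open import Data.List.Relation.Unary.All as All using (All; []; _∷_)
open import Data.List.Relation.Unary.AllPairs using ([]; _∷_)
open import Data.List.Relation.Unary.Unique.Propositional using (Unique)
import Data.List.Relation.Unary.Unique.Propositional.Properties as Unique
open import Data.Nat as ℕ using (ℕ; zero; suc; _+_; _∸_; z≤n; s≤s)
import Data.Nat.Properties as ℕ
open import Data.Nat.DivMod using (m<n⇒m%n≡m; n%n≡0)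
open import Data.Nat.ListAction using (sum)
open import Data.Product using (Σ; ∃; ∃-syntax; _×_; _,_; proj₁; proj₂)
open import Data.Sum using (_⊎_; inj₁; inj₂; [_,_])
open import Data.Vec using (tabulate) renaming (lookup to lookupᵛ)
open import Data.Vec.Properties using (lookup∘tabulate; []=⇒lookup; lookup⇒[]=)
open import Function.Base using (_∘_)
open import Function.Definitions using (Injective)
open import Relation.Nullary using (¬_; Dec; does; yes; no)
open import Relation.Nullary.Decidable using (_×-dec_; _⊎-dec_; _→-dec_; ¬?; decidable-stable)
open import Relation.Unary using (Decidable)
open import Relation.Binary using (tri<; tri≈; tri>)
open import Relation.Binary.PropositionalEquality
  using (_≡_; _≢_; refl; sym; trans; cong; subst; subst₂; module ≡-Reasoning)

Unique⇒length≤ : ∀ {A : Set} {xs ys : List A} → Unique xs → xs ⊆ ys → length xs ℕ.≤ length ys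
Unique⇒length≤ {xs = []} _ _ = z≤n
Unique⇒length≤ {xs = x ∷ xs} (x∉xs ∷ !xs) xs⊆ys with ys₁ , ys₂ , refl ← ∈-∃++ (xs⊆ys (here refl)) =
  ℕ.≤-trans (s≤s (Unique⇒length≤ !xs xs⊆ys₁++ys₂)) (ℕ.≤-reflexive (sym (length-++-sucʳ ys₁ x ys₂)))
  where
  xs⊆ys₁++ys₂ : xs ⊆ ys₁ ++ ys₂
  xs⊆ys₁++ys₂ y∈xs with ∈-++⁻ ys₁ (xs⊆ys (there y∈xs))
  ... | inj₁ y∈ys₁ = ∈-++⁺ˡ y∈ys₁
  ... | inj₂ (here refl) = ⊥-elim (All.lookup x∉xs y∈xs refl)
  ... | inj₂ (there y∈ys₂) = ∈-++⁺ʳ ys₁ y∈ys₂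

-- Shaped so that deg R v and degIn R S v are definitionally instances of count.
count : ∀ {A : Set} → (A → Bool) → List A → ℕ
count p xs = sum (map (λ u → if p u then 1 else 0) xs)

module _ {A : Set} (p : A → Bool) where

  holds? : ∀ u → Dec (p u ≡ true)
  holds? u = p u ≟ᵇ true

  count≡length-filter : ∀ xs → count p xs ≡ length (filter holds? xs)
  count≡length-filter [] = refl
  count≡length-filter (x ∷ xs) with p x
  ... | true = cong suc (count≡length-filter xs)
  ... | false = count≡length-filter xs

  count≤length : ∀ {xs ys} → Unique xs → (∀ {u} → u ∈ xs → p u ≡ true → u ∈ ys) →
                 count p xs ℕ.≤ length ys
  count≤length {xs} !xs covers =
    subst (ℕ._≤ _) (sym (count≡length-filter xs))
      (Unique⇒length≤ (Unique.filter⁺ holds? !xs) λ u∈ →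
        let u∈xs , pu = ∈-filter⁻ holds? {xs = xs} u∈ in covers u∈xs pu)

  length≤count : ∀ {xs ys} → Unique ys → (∀ {u} → u ∈ ys → u ∈ xs × p u ≡ true) →
                 length ys ℕ.≤ count p xs
  length≤count {xs} !ys within =
    subst (_ ℕ.≤_) (sym (count≡length-filter xs))
      (Unique⇒length≤ !ys λ u∈ → let u∈xs , pu = within u∈ in ∈-filter⁺ holds? u∈xs pu)

module _ {n : ℕ} where

  without : (Fin n → Bool) → Fin n → Fin n → Bool
  without A x u = A u ∧ not (does (u ≟ x))

  without⁻ : ∀ A {x u} → without A x u ≡ true → A u ≡ true × u ≢ x
  without⁻ A {x} {u} eq with A u | u ≟ x
  ... | true | no u≢x = refl , u≢x

  without⁺ : ∀ A {x u} → A u ≡ true → u ≢ x → without A x u ≡ true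
  without⁺ A {x} {u} Au u≢x with u ≟ x
  ... | yes u≡x = ⊥-elim (u≢x u≡x)
  ... | no _ rewrite Au = refl

  count-without< : ∀ A {x} → A x ≡ true → count (without A x) (allFin n) ℕ.< count A (allFin n)
  count-without< A {x} Ax =
    subst (ℕ._≤ count A (allFin n)) (cong suc (sym (count≡length-filter (without A x) (allFin n))))
      (length≤count A (x∉ ∷ Unique.filter⁺ (holds? (without A x)) (Unique.allFin⁺ n)) within)
    where
    removed : List (Fin n)
    removed = filter (holds? (without A x)) (allFin n)
    x∉ : All (x ≢_) removed
    x∉ = All.tabulate λ u∈ x≡u → proj₂ (without⁻ A (proj₂ (∈-filter⁻ _ {xs = allFin n} u∈))) (sym x≡u)
    within : ∀ {u} → u ∈ x ∷ removed → u ∈ allFin n × A u ≡ true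
    within (here refl) = ∈-allFin x , Ax
    within (there u∈) = ∈-allFin _ , proj₁ (without⁻ A (proj₂ (∈-filter⁻ _ {xs = allFin n} u∈)))

  _∖_ : List (Fin n) → Fin n → List (Fin n)
  K ∖ u = filter (λ w → ¬? (w ≟ u)) K

  ∈-∖⁻ : ∀ {K u w} → w ∈ K ∖ u → w ∈ K × w ≢ u
  ∈-∖⁻ {K} {u} = ∈-filter⁻ (λ w → ¬? (w ≟ u)) {xs = K}

  ∈-∖⁺ : ∀ {K u w} → w ∈ K → w ≢ u → w ∈ K ∖ u
  ∈-∖⁺ {K} {u} = ∈-filter⁺ (λ w → ¬? (w ≟ u))

  ∖-unique : ∀ {K u} → Unique K → Unique (K ∖ u)
  ∖-unique = Unique.filter⁺ _

  |∖| : ∀ {K u} → Unique K → u ∈ K → suc (length (K ∖ u)) ≡ length K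
  |∖| {K} {u} !K u∈K = ℕ.≤-antisym
    (Unique⇒length≤ (All.tabulate (λ w∈ u≡w → proj₂ (∈-∖⁻ {K = K} w∈) (sym u≡w)) ∷ ∖-unique !K)
      λ { (here refl) → u∈K ; (there w∈) → proj₁ (∈-∖⁻ {K = K} w∈) })
    (Unique⇒length≤ !K K⊆u∷K∖u)
    where
    K⊆u∷K∖u : K ⊆ u ∷ (K ∖ u)
    K⊆u∷K∖u {w} w∈K with w ≟ u
    ... | yes refl = here refl
    ... | no w≢u = there (∈-∖⁺ w∈K w≢u)

∧-intro : ∀ {a b} → a ≡ true → b ≡ true → a ∧ b ≡ true
∧-intro refl refl = refl

∧-true : ∀ {a b} → a ∧ b ≡ true → a ≡ true × b ≡ true
∧-true {true} b≡true = refl , b≡true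

least : ∀ {n} (P : Fin n → Set) → Decidable P → ∃ P → ∃ λ z → P z × (∀ y → P y → z ≤ y)
least {suc n} P P? (w , Pw) with P? zero
... | yes P0 = zero , P0 , λ _ _ → z≤n
... | no ¬P0 with w
...   | zero = ⊥-elim (¬P0 Pw)
...   | suc w′ with z , Pz , z≤ ← least (λ i → P (suc i)) (λ i → P? (suc i)) (w′ , Pw) =
  suc z , Pz , λ { zero P0 → ⊥-elim (¬P0 P0) ; (suc y) Py → s≤s (z≤ y Py) }

greatest : ∀ {n} (P : Fin n → Set) → Decidable P → ∃ P → ∃ λ z → P z × (∀ y → P y → y ≤ z)
greatest {suc n} P P? (w , Pw) with any? (λ i → P? (suc i))
... | yes ∃Psuc with z , Pz , ≤z ← greatest (λ i → P (suc i)) (λ i → P? (suc i)) ∃Psuc =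
  suc z , Pz , λ { zero _ → z≤n ; (suc y) Py → s≤s (≤z y Py) }
... | no ¬∃Psuc with w
...   | zero = zero , Pw , λ { zero _ → z≤n ; (suc y) Py → ⊥-elim (¬∃Psuc (y , Py)) }
...   | suc w′ = ⊥-elim (¬∃Psuc (w′ , Pw))

module _ {n : ℕ} (G : SimpleGraph n) where

  private
    any-true : ∀ (p : Fin n → Bool) xs → any p xs ≡ true → ∃ λ x → p x ≡ true
    any-true p (x ∷ xs) eq with p x in px
    ... | true = x , px
    ... | false = any-true p xs eq

    any-allFin : ∀ (p : Fin n → Bool) {x} xs → x ∈ xs → p x ≡ true → any p xs ≡ true
    any-allFin p (y ∷ xs) (here refl) px rewrite px = refl
    any-allFin p (y ∷ xs) (there x∈) px with p y
    ... | true = refl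
    ... | false = any-allFin p xs x∈ px

  Adj-sym : ∀ {u v} → Adj (E G) u v → Adj (E G) v u
  Adj-sym {u} {v} uv = trans (SimpleGraph.sym G v u) uv

  Adj-irrefl : ∀ {u} → ¬ Adj (E G) u u
  Adj-irrefl {u} uu with () ← trans (sym uu) (SimpleGraph.irrefl G u)

  neighbours : Fin n → List (Fin n)
  neighbours v = filter (holds? (E G v)) (allFin n)

  neighbours⁻ : ∀ {v u} → u ∈ neighbours v → Adj (E G) v u
  neighbours⁻ {v} = proj₂ ∘ ∈-filter⁻ (holds? (E G v)) {xs = allFin n}

  neighbours⁺ : ∀ {v u} → Adj (E G) v u → u ∈ neighbours v
  neighbours⁺ {v} {u} = ∈-filter⁺ (holds? (E G v)) (∈-allFin u)

  neighbours-unique : ∀ v → Unique (neighbours v)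
  neighbours-unique v = Unique.filter⁺ _ (Unique.allFin⁺ n)

  |neighbours| : ∀ v → length (neighbours v) ≡ deg (E G) v
  |neighbours| v = sym (count≡length-filter (E G v) (allFin n))

  square⁻ : ∀ {u v} → Adj (square G) u v →
            u ≢ v × (Adj (E G) u v ⊎ ∃[ w ] Adj (E G) u w × Adj (E G) w v)
  square⁻ {u} {v} sq with u ≟ v | E G u v
  ... | no u≢v | true = u≢v , inj₁ refl
  ... | no u≢v | false with w , uwv ← any-true (λ w → E G u w ∧ E G w v) (allFin n) sq =
    u≢v , inj₂ (w , ∧-true uwv)

  edge⇒square : ∀ {u v} → Adj (E G) u v → Adj (square G) u v
  edge⇒square {u} {v} uv with u ≟ v
  ... | yes refl = ⊥-elim (Adj-irrefl uv)
  ... | no _ rewrite uv = refl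

  path⇒square : ∀ {u v} w → u ≢ v → Adj (E G) u w → Adj (E G) w v → Adj (square G) u v
  path⇒square {u} {v} w u≢v uw wv with u ≟ v
  ... | yes u≡v = ⊥-elim (u≢v u≡v)
  ... | no _ with E G u v
  ...   | true = refl
  ...   | false = any-allFin (λ w → E G u w ∧ E G w v) (allFin n) (∈-allFin w) uwv
    where uwv : E G u w ∧ E G w v ≡ true
          uwv rewrite uw | wv = refl

  square-sym : ∀ {u v} → Adj (square G) u v → Adj (square G) v u
  square-sym sq with square⁻ sq
  ... | u≢v , inj₁ uv = edge⇒square (Adj-sym uv)
  ... | u≢v , inj₂ (w , uw , wv) = path⇒square w (λ v≡u → u≢v (sym v≡u)) (Adj-sym wv) (Adj-sym uw)

  square-irrefl : ∀ {u} → ¬ Adj (square G) u u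
  square-irrefl sq = proj₁ (square⁻ sq) refl

_∈?_ : ∀ {n} (x : Fin n) (L : List (Fin n)) → Dec (x ∈ L)
x ∈? L = Any.any? (x ≟_) L

Degenerate : ∀ {n} → BRel n → ℕ → Set
Degenerate {n} R d = ∀ (S : Fin n → Bool) {v} → S v ≡ true →
  ∃ λ x → S x ≡ true × Σ (List (Fin n)) λ L → length L ℕ.≤ d × (∀ {u} → S u ≡ true → Adj R x u → u ∈ L)

free-colour : ∀ {d} (L : List (Fin (suc d))) → length L ℕ.≤ d → ∃ λ k → k ∉ L
free-colour {d} L |L|≤d with any? (λ k → ¬? (k ∈? L))
... | yes free = free
... | no ¬free = ⊥-elim (ℕ.<-irrefl refl (ℕ.≤-trans
        (subst (ℕ._≤ length L) (length-tabulate (λ k → k)) (Unique⇒length≤ (Unique.allFin⁺ (suc d)) all∈L))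
        |L|≤d))
  where
  all∈L : allFin (suc d) ⊆ L
  all∈L {k} _ with k ∈? L
  ... | yes k∈L = k∈L
  ... | no k∉L = ⊥-elim (¬free (k , k∉L))

ColouringOn : ∀ {n} → BRel n → (k : ℕ) → (Fin n → Bool) → (Fin n → Fin k) → Set
ColouringOn R k S c = ∀ {u v} → S u ≡ true → S v ≡ true → Adj R u v → c u ≢ c v

recolour : ∀ {n k} → Fin n → Fin k → (Fin n → Fin k) → Fin n → Fin k
recolour x k c u with u ≟ x
... | yes _ = k
... | no _ = c u

module _ {n : ℕ} {R : BRel n} where

  clique≤colours : ∀ {m k f c} → IsClique R m f → IsColouring R k c → m ℕ.≤ k
  clique≤colours {f = f} {c} (_ , adj) proper = injective⇒≤ c∘f-injective
    where
    c∘f-injective : Injective _≡_ _≡_ (λ i → c (f i))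
    c∘f-injective {i} {j} ci≡cj with i ≟ j
    ... | yes i≡j = i≡j
    ... | no i≢j = ⊥-elim (proper (f i) (f j) (adj i j i≢j) ci≡cj)

  degenerate⇒minDegree≤ : ∀ {d S e} → Degenerate R d → MinDegreeInIs R S e → e ℕ.≤ d
  degenerate⇒minDegree≤ {d} {S} degenerate ((v , v∈S , _) , e≤deg)
    with x , x∈S , L , |L|≤d , covers ← degenerate (lookupᵛ S) ([]=⇒lookup v∈S) =
    ℕ.≤-trans (e≤deg x (lookup⇒[]= x S x∈S))
      (ℕ.≤-trans (count≤length _ (Unique.allFin⁺ n) λ _ xw∧w∈S →
                  let xw , w∈S = ∧-true xw∧w∈S in covers w∈S xw)
               |L|≤d)

  module _ (R-sym : ∀ {u v} → Adj R u v → Adj R v u) (R-irrefl : ∀ {u} → ¬ Adj R u u) where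

    degenerate⇒colouringOn : ∀ {d} → Degenerate R d → ∀ S → Σ _ (ColouringOn R (suc d) S)
    degenerate⇒colouringOn {d} degenerate S = colour (count S (allFin n)) S ℕ.≤-refl
      where
      colour : ∀ f S → count S (allFin n) ℕ.≤ f → Σ _ (ColouringOn R (suc d) S)
      colour f S |S|≤f with any? (λ v → S v ≟ᵇ true)
      ... | no empty = (λ _ → zero) , λ Su _ _ → ⊥-elim (empty (_ , Su))
      ... | yes (v , Sv) with x , Sx , L , |L|≤d , covers ← degenerate S Sv with f
      ...   | ℕ.zero = ⊥-elim (ℕ.<⇒≱ (ℕ.<-≤-trans (count-without< S Sx) |S|≤f) z≤n)
      ...   | suc f with c , proper ← colour f (without S x) (ℕ.≤-pred (ℕ.<-≤-trans (count-without< S Sx) |S|≤f))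
                    with k , k∉ ← free-colour (map c L) (subst (ℕ._≤ d) (sym (length-map c L)) |L|≤d) =
        recolour x k c , proper′
        where
        proper′ : ColouringOn R (suc d) S (recolour x k c)
        proper′ {u} {v} Su Sv uv with u ≟ x | v ≟ x
        ... | yes refl | yes refl = λ _ → R-irrefl uv
        ... | yes refl | no _ = λ k≡cv → k∉ (subst (_∈ map c L) (sym k≡cv) (∈-map⁺ c (covers Sv uv)))
        ... | no _ | yes refl = λ cu≡k → k∉ (subst (_∈ map c L) cu≡k (∈-map⁺ c (covers Su (R-sym uv))))
        ... | no u≢x | no v≢x = proper (without⁺ S Su u≢x) (without⁺ S Sv v≢x) uv

    degenerate⇒colouring : ∀ {d} → Degenerate R d → Σ _ (IsColouring R (suc d))
    degenerate⇒colouring degenerate with c , proper ← degenerate⇒colouringOn degenerate (λ _ → true) =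
      c , λ u v uv → proper refl refl uv

lookup-injective : ∀ {A : Set} {xs : List A} → Unique xs → Injective _≡_ _≡_ (lookup xs)
lookup-injective {xs = x ∷ xs} (x∉ ∷ !xs) {zero} {zero} _ = refl
lookup-injective {xs = x ∷ xs} (x∉ ∷ !xs) {zero} {suc j} x≡ = ⊥-elim (All.lookup x∉ (∈-lookup j) x≡)
lookup-injective {xs = x ∷ xs} (x∉ ∷ !xs) {suc i} {zero} ≡x = ⊥-elim (All.lookup x∉ (∈-lookup i) (sym ≡x))
lookup-injective {xs = x ∷ xs} (x∉ ∷ !xs) {suc i} {suc j} eq = cong suc (lookup-injective !xs eq)

subsetOf : ∀ {n} → List (Fin n) → Subset n
subsetOf K = tabulate λ u → does (u ∈? K)

∈-subsetOf : ∀ {n} {K : List (Fin n)} {u} → lookupᵛ (subsetOf K) u ≡ true → u ∈ K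
∈-subsetOf {K = K} {u} u∈ rewrite lookup∘tabulate (λ w → does (w ∈? K)) u with u ∈? K
... | yes u∈K = u∈K

subsetOf-∈ : ∀ {n} {K : List (Fin n)} {u} → u ∈ K → lookupᵛ (subsetOf K) u ≡ true
subsetOf-∈ {K = K} {u} u∈K rewrite lookup∘tabulate (λ w → does (w ∈? K)) u with u ∈? K
... | yes _ = refl
... | no u∉K = ⊥-elim (u∉K u∈K)

module _ {n : ℕ} {R : BRel n} (R-irrefl : ∀ {u} → ¬ Adj R u u)
         {K : List (Fin n)} (!K : Unique K) (K-adj : ∀ {a b} → a ∈ K → b ∈ K → a ≢ b → Adj R a b) where

  listClique : IsClique R (length K) (lookup K)
  listClique = lookup-injective !K , λ i j i≢j →
    K-adj (∈-lookup i) (∈-lookup j) (λ Ki≡Kj → i≢j (lookup-injective !K Ki≡Kj))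

  degIn-clique : ∀ {u} → u ∈ K → suc (degIn R (subsetOf K) u) ≡ length K
  degIn-clique {u} u∈K = begin
      suc (degIn R (subsetOf K) u) ≡⟨ cong suc (ℕ.≤-antisym degIn≤ ≤degIn) ⟩
      suc (length (K ∖ u))         ≡⟨ |∖| !K u∈K ⟩
      length K                     ∎
    where
    open ≡-Reasoning
    degIn≤ : degIn R (subsetOf K) u ℕ.≤ length (K ∖ u)
    degIn≤ = count≤length _ (Unique.allFin⁺ n) λ _ uw∧w∈K →
      let uw , w∈K = ∧-true uw∧w∈K
      in ∈-∖⁺ {K = K} (∈-subsetOf w∈K) λ w≡u → R-irrefl (subst (Adj R u) w≡u uw)
    ≤degIn : length (K ∖ u) ℕ.≤ degIn R (subsetOf K) u
    ≤degIn = length≤count _ (∖-unique !K) λ {w} w∈ →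
      let w∈K , w≢u = ∈-∖⁻ {K = K} w∈
      in ∈-allFin w , ∧-intro (K-adj u∈K w∈K λ u≡w → w≢u (sym u≡w)) (subsetOf-∈ w∈K)

  listClique-minDegree : ∀ {d v} → v ∈ K → length K ≡ suc d → MinDegreeInIs R (subsetOf K) d
  listClique-minDegree v∈K |K|≡1+d =
    (_ , lookup⇒[]= _ (subsetOf K) (subsetOf-∈ v∈K) , degIn≡d v∈K) ,
    λ u u∈S → ℕ.≤-reflexive (sym (degIn≡d (∈-subsetOf ([]=⇒lookup u∈S))))
    where
    degIn≡d : ∀ {u} → u ∈ K → degIn R (subsetOf K) u ≡ _
    degIn≡d u∈K = ℕ.suc-injective (trans (degIn-clique u∈K) |K|≡1+d)

DegreeBounded : ∀ {n} → SimpleGraph n → ℕ → Set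
DegreeBounded {n} G Δ = ∀ {v} {L : List (Fin n)} → Unique L → (∀ {u} → u ∈ L → Adj (E G) v u) → length L ℕ.≤ Δ

NonCrossing : ∀ {n} → SimpleGraph n → Set
NonCrossing G = ∀ {i j k l} → i < j → j < k → k < l → Adj (E G) i k → Adj (E G) j l → ⊥

nested-span< : ∀ {a b x y} → a ℕ.≤ x → y ℕ.≤ b → (a ℕ.< x ⊎ y ℕ.< b) → x ℕ.< y → y ∸ x ℕ.< b ∸ a
nested-span< {a} {b} {x} {y} a≤x y≤b (inj₁ a<x) x<y =
  ℕ.≤-<-trans (ℕ.∸-monoˡ-≤ x y≤b) (ℕ.∸-monoʳ-< a<x (ℕ.≤-trans (ℕ.<⇒≤ x<y) y≤b))
nested-span< {a} {b} {x} {y} a≤x y≤b (inj₂ y<b) x<y =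
  ℕ.<-≤-trans (ℕ.∸-monoˡ-< y<b (ℕ.<⇒≤ x<y)) (ℕ.∸-monoʳ-≤ b a≤x)

module _ {A : Set} (p : ℕ → A) (k : ℕ) (y : A) where

  snoc : ℕ → A
  snoc i with i ℕ.≟ suc k
  ... | yes _ = y
  ... | no _ = p i

  snoc-last : snoc (suc k) ≡ y
  snoc-last with suc k ℕ.≟ suc k
  ... | yes _ = refl
  ... | no k≢k = ⊥-elim (k≢k refl)

  snoc-init : ∀ {i} → i ℕ.≤ k → snoc i ≡ p i
  snoc-init {i} i≤k with i ℕ.≟ suc k
  ... | yes refl = ⊥-elim (ℕ.<-irrefl refl i≤k)
  ... | no _ = refl

  snoc-all : ∀ {P : A → Set} → (∀ i → i ℕ.≤ k → P (p i)) → P y → ∀ i → i ℕ.≤ suc k → P (snoc i)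
  snoc-all all Py i i≤1+k with i ℕ.≟ suc k
  ... | yes _ = Py
  ... | no i≢1+k = all i (ℕ.≤-pred (ℕ.≤∧≢⇒< i≤1+k i≢1+k))

  snoc-steps : ∀ {Q : ℕ → A → A → Set} → (∀ i → i ℕ.< k → Q i (p i) (p (suc i))) → Q k (p k) y →
               ∀ i → i ℕ.< suc k → Q i (snoc i) (snoc (suc i))
  snoc-steps {Q} steps last i i<1+k with i ℕ.≟ k
  ... | yes refl = subst₂ (Q i) (sym (snoc-init ℕ.≤-refl)) (sym snoc-last) last
  ... | no i≢k = subst₂ (Q i) (sym (snoc-init (ℕ.≤-pred i<1+k))) (sym (snoc-init i<k)) (steps i i<k)
    where
    i<k : i ℕ.< k
    i<k = ℕ.≤∧≢⇒< (ℕ.≤-pred i<1+k) i≢k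

snoc-increasing : ∀ {n} {p : ℕ → Fin n} {k y} → (∀ i j → i ℕ.< j → j ℕ.≤ k → p i < p j) → p k < y →
                  ∀ i j → i ℕ.< j → j ℕ.≤ suc k → snoc p k y i < snoc p k y j
snoc-increasing {p = p} {k} {y} increasing pk<y i j i<j j≤1+k with ℕ.m≤n⇒m<n∨m≡n j≤1+k
... | inj₂ refl =
  subst₂ _<_ (sym (snoc-init p k y (ℕ.≤-pred i<j))) (sym (snoc-last p k y)) (ℕ.≤-<-trans pi≤pk pk<y)
  where
  pi≤pk : p i ≤ p k
  pi≤pk with i ℕ.≟ k
  ... | yes refl = ℕ.≤-refl
  ... | no i≢k = ℕ.<⇒≤ (increasing i k (ℕ.≤∧≢⇒< (ℕ.≤-pred i<j) i≢k) ℕ.≤-refl)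
... | inj₁ j<1+k = subst₂ _<_ (sym (snoc-init p k y (ℕ.≤-trans (ℕ.<⇒≤ i<j) j≤k))) (sym (snoc-init p k y j≤k))
                   (increasing i j i<j j≤k)
  where
  j≤k : j ℕ.≤ k
  j≤k = ℕ.≤-pred j<1+k

module OuterOrder {n : ℕ} (G : SimpleGraph n) (Δ : ℕ) (Δ≤3 : Δ ℕ.≤ 3)
  (degree≤ : DegreeBounded G Δ) (noncrossing : NonCrossing G) (chordal : Chordal G) where

  _~_ : Fin n → Fin n → Set
  u ~ v = Adj (E G) u v

  ~-sym : ∀ {u v} → u ~ v → v ~ u
  ~-sym = Adj-sym G

  ~⇒≢ : ∀ {u v} → u ~ v → u ≢ v
  ~⇒≢ uv refl = Adj-irrefl G uv

  <⇒≢ : ∀ {i j : Fin n} → i < j → i ≢ j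
  <⇒≢ i<j refl = ℕ.<-irrefl refl i<j

  nested : ∀ {lo hi z w} → lo < hi → lo ~ hi → lo < z → z < hi → z ~ w → lo ≤ w × w ≤ hi
  nested {lo} {hi} {z} {w} lo<hi lo~hi lo<z z<hi z~w with lo ≤? w | w ≤? hi
  ... | yes lo≤w | yes w≤hi = lo≤w , w≤hi
  ... | no lo≰w | _ = ⊥-elim (noncrossing (ℕ.≰⇒> lo≰w) lo<z z<hi (~-sym z~w) lo~hi)
  ... | _ | no w≰hi = ⊥-elim (noncrossing lo<z z<hi (ℕ.≰⇒> w≰hi) lo~hi z~w)

  endpoint-or-inside : ∀ {lo y hi : Fin n} → lo ≤ y → y ≤ hi → y ≡ lo ⊎ y ≡ hi ⊎ (lo < y × y < hi)
  endpoint-or-inside {lo} {y} {hi} lo≤y y≤hi with <-cmp lo y | <-cmp y hi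
  ... | tri≈ _ lo≡y _ | _ = inj₁ (sym lo≡y)
  ... | _ | tri≈ _ y≡hi _ = inj₂ (inj₁ y≡hi)
  ... | tri< lo<y _ _ | tri< y<hi _ _ = inj₂ (inj₂ (lo<y , y<hi))
  ... | tri> _ _ y<lo | _ = ⊥-elim (ℕ.<⇒≱ y<lo lo≤y)
  ... | _ | tri> _ _ hi<y = ⊥-elim (ℕ.<⇒≱ hi<y y≤hi)

  |neighbours|≤Δ : ∀ v → length (neighbours G v) ℕ.≤ Δ
  |neighbours|≤Δ v = degree≤ (neighbours-unique G v) (neighbours⁻ G)

  only-three-neighbours : ∀ {u a b c} → a ≢ b → a ≢ c → b ≢ c → u ~ a → u ~ b → u ~ c →
                          ∀ {y} → u ~ y → y ≡ a ⊎ y ≡ b ⊎ y ≡ c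
  only-three-neighbours {u} {a} {b} {c} a≢b a≢c b≢c ua ub uc {y} uy with y ≟ a | y ≟ b | y ≟ c
  ... | yes y≡a | _ | _ = inj₁ y≡a
  ... | _ | yes y≡b | _ = inj₂ (inj₁ y≡b)
  ... | _ | _ | yes y≡c = inj₂ (inj₂ y≡c)
  ... | no y≢a | no y≢b | no y≢c = ⊥-elim (ℕ.<-irrefl refl (ℕ.≤-trans four≤Δ Δ≤3))
    where
    four≤Δ : 4 ℕ.≤ Δ
    four≤Δ = degree≤ ((y≢a ∷ y≢b ∷ y≢c ∷ []) ∷ (a≢b ∷ a≢c ∷ []) ∷ (b≢c ∷ []) ∷ [] ∷ [])
      λ { (here refl) → uy ; (there (here refl)) → ua ; (there (there (here refl))) → ub
        ; (there (there (there (here refl)))) → uc }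

  three-neighbours⇒3≤Δ : ∀ {u a b c} → a ≢ b → a ≢ c → b ≢ c → u ~ a → u ~ b → u ~ c → 3 ℕ.≤ Δ
  three-neighbours⇒3≤Δ a≢b a≢c b≢c ua ub uc =
    degree≤ ((a≢b ∷ a≢c ∷ []) ∷ (b≢c ∷ []) ∷ [] ∷ [])
      λ { (here refl) → ua ; (there (here refl)) → ub ; (there (there (here refl))) → uc }

  record GreedyCycle (m : ℕ) (q : ℕ → Fin n) : Set where
    field
      increasing : ∀ i j → i ℕ.< j → j ℕ.≤ 3 + m → q i < q j
      steps      : ∀ i → i ℕ.< 3 + m → q i ~ q (suc i)
      closes     : q (3 + m) ~ q 0
      greedy     : ∀ i j → 1 ℕ.≤ i → i ℕ.< 3 + m → j ℕ.≤ 3 + m → q i ~ q j → q j ≤ q (suc i)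
      greedy₀    : ∀ j → j ℕ.< 3 + m → q 0 ~ q j → q j ≤ q 1

  -- A chord q I ~ q J (I + 1 < J) would exceed the greedy bound q J ≤ q (I + 1) < q J.
  greedy-chord-absurd : ∀ {m q} → GreedyCycle m q → ∀ I J → I ℕ.< J → J ℕ.≤ 3 + m → q I ~ q J →
                        J ≢ suc I → ¬ (I ≡ 0 × J ≡ 3 + m) → ⊥
  greedy-chord-absurd {m} C ℕ.zero J 0<J J≤3+m chord J≢1 not-closing with J ℕ.≟ 3 + m
  ... | yes J≡3+m = not-closing (refl , J≡3+m)
  ... | no J≢3+m = ℕ.<⇒≱ (increasing 1 J (ℕ.≤∧≢⇒< 0<J (λ 1≡J → J≢1 (sym 1≡J))) J≤3+m)
                          (greedy₀ J (ℕ.≤∧≢⇒< J≤3+m J≢3+m) chord)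
    where open GreedyCycle C
  greedy-chord-absurd C (suc I) J I<J J≤3+m chord J≢2+I _ =
    ℕ.<⇒≱ (increasing (suc (suc I)) J (ℕ.≤∧≢⇒< I<J (λ 2+I≡J → J≢2+I (sym 2+I≡J))) J≤3+m)
          (greedy (suc I) J (s≤s z≤n) (ℕ.<-≤-trans I<J J≤3+m) J≤3+m chord)
    where open GreedyCycle C

  ¬GreedyCycle : ∀ {m q} → ¬ GreedyCycle m q
  ¬GreedyCycle {m} {q} C = no-chord (chordal m cycle (cycle-injective , cycle-steps))
    where
    open GreedyCycle C
    cycle : Fin (4 + m) → Fin n
    cycle i = q (toℕ i)
    ≤3+m : ∀ (i : Fin (4 + m)) → toℕ i ℕ.≤ 3 + m
    ≤3+m i = ℕ.≤-pred (toℕ<n i)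
    wraps : ∀ {i : ℕ} → i ≡ 3 + m → suc i ℕ.% (4 + m) ≡ 0
    wraps i≡3+m = trans (cong (λ t → suc t ℕ.% (4 + m)) i≡3+m) (n%n≡0 (4 + m))
    cycle-injective : Injective _≡_ _≡_ cycle
    cycle-injective {i} {j} qi≡qj with ℕ.<-cmp (toℕ i) (toℕ j)
    ... | tri< i<j _ _ = ⊥-elim (<⇒≢ (increasing _ _ i<j (≤3+m j)) qi≡qj)
    ... | tri≈ _ i≡j _ = toℕ-injective i≡j
    ... | tri> _ _ j<i = ⊥-elim (<⇒≢ (increasing _ _ j<i (≤3+m i)) (sym qi≡qj))
    cycle-steps : ∀ i j → CycNext m i j → cycle i ~ cycle j
    cycle-steps i j next with ℕ.<-cmp (toℕ i) (3 + m)
    ... | tri< i<3+m _ _ =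
      subst (λ t → q (toℕ i) ~ q t) (sym (trans next (m<n⇒m%n≡m (s≤s i<3+m)))) (steps (toℕ i) i<3+m)
    ... | tri≈ _ i≡3+m _ = subst₂ (λ s t → q s ~ q t) (sym i≡3+m) (sym (trans next (wraps i≡3+m))) closes
    ... | tri> _ _ 3+m<i = ⊥-elim (ℕ.<⇒≱ 3+m<i (≤3+m i))
    ordered-chord : ∀ i j → toℕ i ℕ.< toℕ j → cycle i ~ cycle j → ¬ CycNext m i j → ¬ CycNext m j i → ⊥
    ordered-chord i j i<j chord ¬ij ¬ji = greedy-chord-absurd C (toℕ i) (toℕ j) i<j (≤3+m j) chord
      (λ j≡1+i → ¬ij (trans j≡1+i (sym (m<n⇒m%n≡m (s≤s (subst (ℕ._≤ 3 + m) j≡1+i (≤3+m j)))))))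
      (λ { (i≡0 , j≡3+m) → ¬ji (trans i≡0 (sym (wraps j≡3+m))) })
    no-chord : ¬ (∃[ i ] ∃[ j ] (cycle i ~ cycle j × ¬ CycNext m i j × ¬ CycNext m j i))
    no-chord (i , j , chord , ¬ij , ¬ji) with ℕ.<-cmp (toℕ i) (toℕ j)
    ... | tri≈ _ i≡j _ = ~⇒≢ chord (cong q i≡j)
    ... | tri< i<j _ _ = ordered-chord i j i<j chord ¬ij ¬ji
    ... | tri> _ _ j<i = ordered-chord j i j<i (~-sym chord) ¬ji ¬ij

  replace : Fin n → Fin n → Fin n → Fin n
  replace x e u with u ≟ x
  ... | yes _ = e
  ... | no _ = u

  replace-∈ : ∀ {x e L} → x ∈ L → e ∈ map (replace x e) L
  replace-∈ {x} {e} x∈L = subst (_∈ map (replace x e) _) (replace-self x) (∈-map⁺ (replace x e) x∈L)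
    where
    replace-self : ∀ x → replace x e x ≡ e
    replace-self x with x ≟ x
    ... | yes _ = refl
    ... | no x≢x = ⊥-elim (x≢x refl)

  ∈-replace : ∀ {x e u L} → u ∈ L → u ≢ x → u ∈ map (replace x e) L
  ∈-replace {x} {e} {u} u∈L u≢x = subst (_∈ map (replace x e) _) replace-other (∈-map⁺ (replace x e) u∈L)
    where
    replace-other : replace x e u ≡ u
    replace-other with u ≟ x
    ... | yes u≡x = ⊥-elim (u≢x u≡x)
    ... | no _ = refl

  EndpointsOf : Fin n → Fin n → Fin n → Fin n → Set
  EndpointsOf lo hi x e = x ≡ lo × e ≡ hi ⊎ x ≡ hi × e ≡ lo

  endpoints-adjacent : ∀ {lo hi x e} → EndpointsOf lo hi x e → lo ~ hi → x ~ e
  endpoints-adjacent (inj₁ (refl , refl)) lo~hi = lo~hi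
  endpoints-adjacent (inj₂ (refl , refl)) lo~hi = ~-sym lo~hi

  other-endpoint : ∀ {lo hi x e y} → EndpointsOf lo hi x e → lo ≤ y → y ≤ hi → y ≢ x →
                   y ≡ e ⊎ (lo < y × y < hi)
  other-endpoint {y = y} ends lo≤y y≤hi y≢x with endpoint-or-inside lo≤y y≤hi | ends
  ... | inj₁ refl | inj₁ (refl , _) = ⊥-elim (y≢x refl)
  ... | inj₁ refl | inj₂ (_ , refl) = inj₁ refl
  ... | inj₂ (inj₁ refl) | inj₁ (_ , refl) = inj₁ refl
  ... | inj₂ (inj₁ refl) | inj₂ (refl , _) = ⊥-elim (y≢x refl)
  ... | inj₂ (inj₂ inside) | _ = inj₂ inside

  apex-adjacent : ∀ {lo hi x e t} → EndpointsOf lo hi x e → t ~ lo → t ~ hi → t ~ e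
  apex-adjacent (inj₁ (_ , refl)) _ t~hi = t~hi
  apex-adjacent (inj₂ (_ , refl)) t~lo _ = t~lo

  module Alive (A : Fin n → Bool) where

    Alive : Fin n → Set
    Alive u = A u ≡ true

    alive? : Decidable Alive
    alive? u = A u ≟ᵇ true

    Near : Fin n → Fin n → Set
    Near x y = x ≢ y × (x ~ y ⊎ ∃[ w ] (Alive w × x ~ w × w ~ y))

    Simplicial : Fin n → Set
    Simplicial x = ∀ y z → Alive y → Alive z → x ~ y → x ~ z → y ≢ z → y ~ z

    Sparse : Fin n → Set
    Sparse x = Σ (List (Fin n)) λ L → length L ℕ.≤ Δ × (∀ y → Alive y → Near x y → y ∈ L)

    Good : Fin n → Set
    Good x = Alive x × Simplicial x × Sparse x

    Between : Fin n → Fin n → Fin n → Set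
    Between x y z = Alive z × x < z × z < y

    Apex : Fin n → Fin n → Fin n → Set
    Apex x y z = Between x y z × z ~ x × z ~ y × (∀ z′ → Between x y z′ → z′ ≡ z)

    Thin : Fin n → Fin n → Set
    Thin x y = (∀ z → ¬ Between x y z) ⊎ ∃ (Apex x y)

    AliveEdge : Fin n → Fin n → Set
    AliveEdge x y = Alive x × Alive y × x < y × x ~ y

    isolated⇒good : ∀ {x} → Alive x → (∀ y → Alive y → ¬ x ~ y) → Good x
    isolated⇒good Ax isolated = Ax , (λ y _ Ay _ xy _ _ → ⊥-elim (isolated y Ay xy)) , [] , z≤n , λ where
      y Ay (_ , inj₁ xy) → ⊥-elim (isolated y Ay xy)
      y Ay (_ , inj₂ (w , Aw , xw , _)) → ⊥-elim (isolated w Aw xw)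

    NeighboursWithin : Fin n → Fin n → Fin n → Set
    NeighboursWithin x lo hi = ∀ y → Alive y → x ~ y → lo ≤ y × y ≤ hi

    endpoint-neighbour : ∀ {lo hi x e} → EndpointsOf lo hi x e → NeighboursWithin x lo hi →
                         ∀ y → Alive y → x ~ y → y ≡ e ⊎ Between lo hi y
    endpoint-neighbour ends within y Ay xy with lo≤y , y≤hi ← within y Ay xy
      with other-endpoint ends lo≤y y≤hi (λ y≡x → ~⇒≢ xy (sym y≡x))
    ... | inj₁ y≡e = inj₁ y≡e
    ... | inj₂ (lo<y , y<hi) = inj₂ (Ay , lo<y , y<hi)

    endpoint-simplicial : ∀ {lo hi x e} → Thin lo hi → EndpointsOf lo hi x e → NeighboursWithin x lo hi →
                          Simplicial x
    endpoint-simplicial thin ends within y z Ay Az xy xz y≢z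
      with endpoint-neighbour ends within y Ay xy | endpoint-neighbour ends within z Az xz | thin
    ... | inj₁ refl | inj₁ refl | _ = ⊥-elim (y≢z refl)
    ... | inj₂ y-in | _ | inj₁ empty = ⊥-elim (empty y y-in)
    ... | _ | inj₂ z-in | inj₁ empty = ⊥-elim (empty z z-in)
    ... | inj₂ y-in | inj₂ z-in | inj₂ (t , _ , _ , _ , unique) =
      ⊥-elim (y≢z (trans (unique y y-in) (sym (unique z z-in))))
    ... | inj₁ refl | inj₂ z-in | inj₂ (t , _ , t~lo , t~hi , unique) rewrite unique z z-in =
      ~-sym (apex-adjacent ends t~lo t~hi)
    ... | inj₂ y-in | inj₁ refl | inj₂ (t , _ , t~lo , t~hi , unique) rewrite unique y y-in =
      apex-adjacent ends t~lo t~hi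

    -- Near x ⊆ {e} ∪ N(e) ∖ {x}, and replacing x by e in the neighbour list of e keeps its length ≤ Δ.
    endpoint-sparse : ∀ {lo hi x e} → lo < hi → lo ~ hi → Thin lo hi → EndpointsOf lo hi x e →
                      NeighboursWithin x lo hi → Sparse x
    endpoint-sparse {lo} {hi} {x} {e} lo<hi lo~hi thin ends within = L , |L|≤Δ , covers thin
      where
      L : List (Fin n)
      L = map (replace x e) (neighbours G e)
      |L|≤Δ : length L ℕ.≤ Δ
      |L|≤Δ = subst (ℕ._≤ Δ) (sym (length-map (replace x e) (neighbours G e))) (|neighbours|≤Δ e)
      e∈L : e ∈ L
      e∈L = replace-∈ (neighbours⁺ G (~-sym (endpoints-adjacent ends lo~hi)))
      via-e : ∀ {y} → e ~ y → y ≢ x → y ∈ L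
      via-e ey y≢x = ∈-replace (neighbours⁺ G ey) y≢x
      covers : Thin lo hi → ∀ y → Alive y → Near x y → y ∈ L
      covers thin y Ay (x≢y , inj₁ xy) with endpoint-neighbour ends within y Ay xy | thin
      ... | inj₁ refl | _ = e∈L
      ... | inj₂ y-in | inj₁ empty = ⊥-elim (empty y y-in)
      ... | inj₂ y-in | inj₂ (t , _ , t~lo , t~hi , unique) rewrite unique y y-in =
        via-e (~-sym (apex-adjacent ends t~lo t~hi)) (λ t≡x → x≢y (sym t≡x))
      covers thin y Ay (x≢y , inj₂ (w , Aw , xw , wy)) with endpoint-neighbour ends within w Aw xw | thin
      ... | inj₁ refl | _ = via-e wy (λ y≡x → x≢y (sym y≡x))
      ... | inj₂ w-in | inj₁ empty = ⊥-elim (empty w w-in)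
      ... | inj₂ w-in@(_ , lo<w , w<hi) | inj₂ (t , _ , _ , _ , unique)
            with lo≤y , y≤hi ← nested lo<hi lo~hi lo<w w<hi wy
            with other-endpoint ends lo≤y y≤hi (λ y≡x → x≢y (sym y≡x))
      ...   | inj₁ refl = e∈L
      ...   | inj₂ (lo<y , y<hi) = ⊥-elim (~⇒≢ wy (trans (unique w w-in) (sym (unique y (Ay , lo<y , y<hi)))))

    endpoint⇒good : ∀ {lo hi x e} → AliveEdge lo hi → Thin lo hi → EndpointsOf lo hi x e →
                    NeighboursWithin x lo hi → Good x
    endpoint⇒good (Alo , Ahi , lo<hi , lo~hi) thin ends within =
      [ (λ (x≡lo , _) → subst Alive (sym x≡lo) Alo) , (λ (x≡hi , _) → subst Alive (sym x≡hi) Ahi) ] ends ,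
      endpoint-simplicial thin ends within , endpoint-sparse lo<hi lo~hi thin ends within

    -- z hangs off the triangle z u v, whose edge u v also lies in the triangle u v t.
    two-triangles⇒good : ∀ {z u v t} → Alive z → z ~ u → z ~ v → u ~ v → u ~ t → v ~ t →
      z ≢ u → z ≢ v → z ≢ t → u ≢ v → u ≢ t → v ≢ t →
      (∀ y → Alive y → z ~ y → y ≡ u ⊎ y ≡ v) → Good z
    two-triangles⇒good {z} {u} {v} {t} Az zu zv uv ut vt z≢u z≢v z≢t u≢v u≢t v≢t only-u-v =
      Az , simplicial , u ∷ v ∷ t ∷ [] , three-neighbours⇒3≤Δ z≢v z≢t v≢t (~-sym zu) uv ut , covers
      where
      simplicial : Simplicial z
      simplicial y y′ Ay Ay′ zy zy′ y≢y′ with only-u-v y Ay zy | only-u-v y′ Ay′ zy′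
      ... | inj₁ refl | inj₁ refl = ⊥-elim (y≢y′ refl)
      ... | inj₁ refl | inj₂ refl = uv
      ... | inj₂ refl | inj₁ refl = ~-sym uv
      ... | inj₂ refl | inj₂ refl = ⊥-elim (y≢y′ refl)
      covers : ∀ y → Alive y → Near z y → y ∈ u ∷ v ∷ t ∷ []
      covers y Ay (z≢y , inj₁ zy) with only-u-v y Ay zy
      ... | inj₁ refl = here refl
      ... | inj₂ refl = there (here refl)
      covers y Ay (z≢y , inj₂ (w , Aw , zw , wy)) with only-u-v w Aw zw
      ... | inj₁ refl with only-three-neighbours z≢v z≢t v≢t (~-sym zu) uv ut wy
      ...   | inj₁ refl = ⊥-elim (z≢y refl)
      ...   | inj₂ (inj₁ refl) = there (here refl)
      ...   | inj₂ (inj₂ refl) = there (there (here refl))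
      covers y Ay (z≢y , inj₂ (w , Aw , zw , wy)) | inj₂ refl
            with only-three-neighbours z≢u z≢t u≢t (~-sym zv) (~-sym uv) vt wy
      ...   | inj₁ refl = ⊥-elim (z≢y refl)
      ...   | inj₂ (inj₁ refl) = here refl
      ...   | inj₂ (inj₂ refl) = there (there (here refl))

    between? : ∀ x y → Decidable (Between x y)
    between? x y z = alive? z ×-dec (x <? z ×-dec z <? y)

    thin? : ∀ x y → Dec (Thin x y)
    thin? x y = all? (λ z → ¬? (between? x y z)) ⊎-dec
      any? (λ z → between? x y z ×-dec (holds? (E G z) x) ×-dec (holds? (E G z) y) ×-dec
        all? (λ z′ → between? x y z′ →-dec (z′ ≟ z)))

    aliveEdge? : ∀ x y → Dec (AliveEdge x y)
    aliveEdge? x y = alive? x ×-dec alive? y ×-dec x <? y ×-dec (holds? (E G x) y)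

    aliveNeighbour? : ∀ x → Decidable (λ y → Alive y × x ~ y)
    aliveNeighbour? x y = alive? y ×-dec (holds? (E G x) y)

    leftmost⇒good : ∀ {x} → Alive x → (∀ y → Alive y → x ~ y → x < y × Thin x y) → Good x
    leftmost⇒good {x} Ax right with any? (aliveNeighbour? x)
    ... | no none = isolated⇒good Ax λ y Ay xy → none (y , Ay , xy)
    ... | yes some with y , (Ay , xy) , ≤y ← greatest _ (aliveNeighbour? x) some =
      endpoint⇒good (Ax , Ay , proj₁ (right y Ay xy) , xy) (proj₂ (right y Ay xy)) (inj₁ (refl , refl))
        λ y′ Ay′ xy′ → ℕ.<⇒≤ (proj₁ (right y′ Ay′ xy′)) , ≤y y′ (Ay′ , xy′)

    rightmost⇒good : ∀ {x} → Alive x → (∀ y → Alive y → x ~ y → y < x × Thin y x) → Good x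
    rightmost⇒good {x} Ax left with any? (aliveNeighbour? x)
    ... | no none = isolated⇒good Ax λ y Ay xy → none (y , Ay , xy)
    ... | yes some with y , (Ay , xy) , y≤ ← least _ (aliveNeighbour? x) some =
      endpoint⇒good (Ay , Ax , proj₁ (left y Ay xy) , ~-sym xy) (proj₂ (left y Ay xy)) (inj₂ (refl , refl))
        λ y′ Ay′ xy′ → y≤ y′ (Ay′ , xy′) , ℕ.<⇒≤ (proj₁ (left y′ Ay′ xy′))

    all-thin⇒good : (∀ a b → AliveEdge a b → Thin a b) → ∀ {v} → Alive v → ∃ Good
    all-thin⇒good all-thin {v} Av with x , Ax , x≤ ← least Alive alive? (v , Av) =
      x , leftmost⇒good Ax λ y Ay xy →
        let x<y = ≤∧≢⇒< (x≤ y Ay) (~⇒≢ xy) in x<y , all-thin x y (Ax , Ay , x<y , xy)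

    apex-neighbours : ∀ {lo hi z} → lo < hi → lo ~ hi → Apex lo hi z →
                      ∀ y → Alive y → z ~ y → y ≡ lo ⊎ y ≡ hi
    apex-neighbours lo<hi lo~hi ((_ , lo<z , z<hi) , _ , _ , unique) y Ay zy
      with lo≤y , y≤hi ← nested lo<hi lo~hi lo<z z<hi zy with endpoint-or-inside lo≤y y≤hi
    ... | inj₁ y≡lo = inj₁ y≡lo
    ... | inj₂ (inj₁ y≡hi) = inj₂ y≡hi
    ... | inj₂ (inj₂ (lo<y , y<hi)) = ⊥-elim (~⇒≢ zy (sym (unique y (Ay , lo<y , y<hi))))

    module Innermost {a b : Fin n} (ab : AliveEdge a b) (¬thin : ¬ Thin a b)
      (inner-thin : ∀ x y → a ≤ x → y ≤ b → (a < x ⊎ y < b) → AliveEdge x y → Thin x y) where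

      Aa : Alive a
      Aa = proj₁ ab

      Ab : Alive b
      Ab = proj₁ (proj₂ ab)

      a<b : a < b
      a<b = proj₁ (proj₂ (proj₂ ab))

      a~b : a ~ b
      a~b = proj₂ (proj₂ (proj₂ ab))

      inner-neighbour? : Decidable (λ y → Between a b y × a ~ y)
      inner-neighbour? y = between? a b y ×-dec (holds? (E G a) y)

      between-neighbour : ∀ {z w} → Between a b z → z ~ w → a ≤ w × w ≤ b
      between-neighbour (_ , a<z , z<b) = nested a<b a~b a<z z<b

      triangle⇒good : ∀ {x} → Between a b x → a ~ x → x ~ b → ∃ Good
      triangle⇒good {x} x-in@(Ax , a<x , x<b) a~x x~b =
        split (inner-thin a x ℕ.≤-refl (ℕ.<⇒≤ x<b) (inj₂ x<b) (Aa , Ax , a<x , a~x))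
              (inner-thin x b (ℕ.<⇒≤ a<x) ℕ.≤-refl (inj₁ a<x) (Ax , Ab , x<b , x~b))
        where
        split : Thin a x → Thin x b → ∃ Good
        split (inj₁ empty-ax) (inj₁ empty-xb) = ⊥-elim (¬thin (inj₂ (x , x-in , ~-sym a~x , x~b , only-x)))
          where
          only-x : ∀ z → Between a b z → z ≡ x
          only-x z (Az , a<z , z<b) with <-cmp z x
          ... | tri< z<x _ _ = ⊥-elim (empty-ax z (Az , a<z , z<x))
          ... | tri≈ _ z≡x _ = z≡x
          ... | tri> _ _ x<z = ⊥-elim (empty-xb z (Az , x<z , z<b))
        split (inj₂ (z , apex@((Az , a<z , z<x) , z~a , z~x , _))) _ =
          z , two-triangles⇒good Az z~a z~x a~x a~b x~b
            (<⇒≢ a<z ∘ sym) (<⇒≢ z<x) (<⇒≢ (<-trans z<x x<b)) (<⇒≢ a<x) (<⇒≢ a<b) (<⇒≢ x<b)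
            (apex-neighbours a<x a~x apex)
        split (inj₁ _) (inj₂ (z , apex@((Az , x<z , z<b) , z~x , z~b , _))) =
          z , two-triangles⇒good Az z~x z~b x~b (~-sym a~x) (~-sym a~b)
            (<⇒≢ x<z ∘ sym) (<⇒≢ z<b) (<⇒≢ (<-trans a<x x<z) ∘ sym) (<⇒≢ x<b) (<⇒≢ a<x ∘ sym) (<⇒≢ a<b ∘ sym)
            (apex-neighbours x<b x~b apex)

      no-inner-neighbour⇒good : (∀ y → Between a b y → ¬ a ~ y) → ∃ Good
      no-inner-neighbour⇒good a-alone with any? (between? a b)
      ... | no none = ⊥-elim (¬thin (inj₁ λ z z-in → none (z , z-in)))
      ... | yes some with x , x-in@(Ax , a<x , x<b) , x≤ ← least (Between a b) (between? a b) some =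
        x , leftmost⇒good Ax λ y Ay xy →
          let x<y = right y Ay xy
          in x<y , inner-thin x y (ℕ.<⇒≤ a<x) (proj₂ (between-neighbour x-in xy)) (inj₁ a<x) (Ax , Ay , x<y , xy)
        where
        right : ∀ y → Alive y → x ~ y → x < y
        right y Ay xy with <-cmp y x
        ... | tri≈ _ y≡x _ = ⊥-elim (~⇒≢ xy (sym y≡x))
        ... | tri> _ _ x<y = x<y
        ... | tri< y<x _ _ with <-cmp a y
        ...   | tri≈ _ a≡y _ = ⊥-elim (a-alone x x-in (subst (_~ x) (sym a≡y) (~-sym xy)))
        ...   | tri> _ _ y<a = ⊥-elim (ℕ.<⇒≱ y<a (proj₁ (between-neighbour x-in xy)))
        ...   | tri< a<y _ _ = ⊥-elim (ℕ.<⇒≱ y<x (x≤ y (Ay , a<y , <-trans y<x x<b)))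

      GreedyStep : ℕ → Fin n → Fin n → Set
      GreedyStep i u v = 1 ℕ.≤ i → ∀ y → Alive y → u ~ y → y ≤ v

      record GreedyPath (k : ℕ) (p : ℕ → Fin n) : Set where
        field
          starts     : p 0 ≡ a
          nonempty   : 1 ℕ.≤ k
          increasing : ∀ i j → i ℕ.< j → j ℕ.≤ k → p i < p j
          steps      : ∀ i → i ℕ.< k → p i ~ p (suc i)
          greedy     : ∀ i → i ℕ.< k → GreedyStep i (p i) (p (suc i))
          greedy₀    : ∀ y → Alive y → a ~ y → y < b → y ≤ p 1
          alive      : ∀ i → i ℕ.≤ k → Alive (p i)
          below      : p k < b

        below-b : ∀ i → i ℕ.≤ k → p i < b
        below-b i i≤k with ℕ.m≤n⇒m<n∨m≡n i≤k
        ... | inj₁ i<k = <-trans (increasing i k i<k ℕ.≤-refl) below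
        ... | inj₂ refl = below

        between-ab : ∀ i → 1 ℕ.≤ i → i ℕ.≤ k → Between a b (p i)
        between-ab i 1≤i i≤k = alive i i≤k , subst (_< p i) starts (increasing 0 i 1≤i i≤k) , below-b i i≤k

      extend-path : ∀ {k p y} → GreedyPath k p → Alive y → p k ~ y → p k < y → y < b →
                    (∀ z → Alive z → p k ~ z → z ≤ y) → GreedyPath (suc k) (snoc p k y)
      extend-path {k} {p} {y} P Ay pk~y pk<y y<b ≤y = record
        { starts     = trans (snoc-init p k y z≤n) starts
        ; nonempty   = s≤s z≤n
        ; increasing = snoc-increasing increasing pk<y
        ; steps      = snoc-steps p k y {Q = λ _ → _~_} steps pk~y
        ; greedy     = snoc-steps p k y {Q = GreedyStep} greedy (λ _ → ≤y)
        ; greedy₀    = λ z Az a~z z<b → subst (z ≤_) (sym (snoc-init p k y nonempty)) (greedy₀ z Az a~z z<b)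
        ; alive      = snoc-all p k y {P = Alive} alive Ay
        ; below      = subst (_< b) (sym (snoc-last p k y)) y<b
        }
        where open GreedyPath P

      -- Closing the path with the edge b a gives a cycle whose chords are excluded by greediness.
      closing-cycle : ∀ {m p} → GreedyPath (2 + m) p → p (2 + m) ~ b → GreedyCycle m (snoc p (2 + m) b)
      closing-cycle {m} {p} P p~b = record
        { increasing = snoc-increasing increasing below
        ; steps      = snoc-steps p k b {Q = λ _ → _~_} steps p~b
        ; closes     = subst₂ _~_ (sym (snoc-last p k b)) (sym (trans (snoc-init p k b z≤n) starts)) (~-sym a~b)
        ; greedy     = λ i j 1≤i i<3+m j≤3+m qi~qj →
            bounded-greedy i i<3+m 1≤i (q j) (q-alive j j≤3+m) qi~qj (q≤b j j≤3+m)
        ; greedy₀    = λ j j<3+m q0~qj →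
            subst₂ _≤_ (sym (snoc-init p k b (ℕ.≤-pred j<3+m))) (sym (snoc-init p k b (s≤s z≤n)))
              (greedy₀ (p j) (alive j (ℕ.≤-pred j<3+m))
                 (subst₂ _~_ (trans (snoc-init p k b z≤n) starts) (snoc-init p k b (ℕ.≤-pred j<3+m)) q0~qj)
                 (below-b j (ℕ.≤-pred j<3+m)))
        }
        where
        open GreedyPath P
        k : ℕ
        k = 2 + m
        q : ℕ → Fin n
        q = snoc p k b
        q-alive : ∀ j → j ℕ.≤ suc k → Alive (q j)
        q-alive = snoc-all p k b {P = Alive} alive Ab
        q≤b : ∀ j → j ℕ.≤ suc k → q j ≤ b
        q≤b = snoc-all p k b {P = _≤ b} (λ i i≤k → ℕ.<⇒≤ (below-b i i≤k)) ℕ.≤-refl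
        bounded-greedy : ∀ i → i ℕ.< suc k → 1 ℕ.≤ i → ∀ y → Alive y → q i ~ y → y ≤ b → y ≤ q (suc i)
        bounded-greedy = snoc-steps p k b {Q = λ i u v → 1 ℕ.≤ i → ∀ y → Alive y → u ~ y → y ≤ b → y ≤ v}
          (λ i i<k 1≤i y Ay pi~y _ → greedy i i<k 1≤i y Ay pi~y) λ _ _ _ _ y≤b → y≤b

      reaches-b⇒good : ∀ k p → GreedyPath k p → p k ~ b → ∃ Good
      reaches-b⇒good 0 p P _ with () ← GreedyPath.nonempty P
      reaches-b⇒good 1 p P p1~b =
        triangle⇒good (between-ab 1 ℕ.≤-refl ℕ.≤-refl) (subst (_~ p 1) starts (steps 0 ℕ.≤-refl)) p1~b
        where open GreedyPath P
      reaches-b⇒good (suc (suc m)) p P p~b = ⊥-elim (¬GreedyCycle (closing-cycle P p~b))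

      stuck⇒good : ∀ {x} → Between a b x → (∀ y → Alive y → x ~ y → y ≤ x) → Good x
      stuck⇒good {x} x-in@(Ax , _ , x<b) ≤x = rightmost⇒good Ax λ y Ay xy →
        let y<x = ≤∧≢⇒< (≤x y Ay xy) (~⇒≢ xy ∘ sym)
        in y<x , inner-thin y x (proj₁ (between-neighbour x-in xy)) (ℕ.<⇒≤ x<b) (inj₂ x<b)
                            (Ay , Ax , y<x , ~-sym xy)

      last-neighbour : ∀ {k p} → GreedyPath (suc k) p → ∃ λ y → Alive y × p (suc k) ~ y
      last-neighbour {k} {p} P = p k , alive k (ℕ.n≤1+n k) , ~-sym (steps k ℕ.≤-refl)
        where open GreedyPath P

      walk : ∀ f k p → toℕ b ∸ toℕ (p k) ℕ.≤ f → GreedyPath k p → ∃ Good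
      walk f 0 p _ P with () ← GreedyPath.nonempty P
      walk 0 (suc k) p fuel P = ⊥-elim (ℕ.<⇒≱ (ℕ.m<n⇒0<n∸m (GreedyPath.below P)) fuel)
      walk (suc f) (suc k) p fuel P
        with y , (Ay , x~y) , ≤y ← greatest _ (aliveNeighbour? (p (suc k))) (last-neighbour P)
        with p (suc k) <? y
      ... | no x≮y = p (suc k) , stuck⇒good x-in λ z Az x~z → ℕ.≤-trans (≤y z (Az , x~z)) (ℕ.≮⇒≥ x≮y)
        where
        x-in : Between a b (p (suc k))
        x-in = GreedyPath.between-ab P (suc k) (s≤s z≤n) ℕ.≤-refl
      ... | yes x<y with y ≟ b
      ...   | yes refl = reaches-b⇒good (suc k) p P x~y
      ...   | no y≢b = walk f (suc (suc k)) (snoc p (suc k) y) fuel′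
                         (extend-path P Ay x~y x<y y<b λ z Az x~z → ≤y z (Az , x~z))
        where
        y<b : y < b
        y<b = ≤∧≢⇒< (proj₂ (between-neighbour (GreedyPath.between-ab P (suc k) (s≤s z≤n) ℕ.≤-refl) x~y)) y≢b
        fuel′ : toℕ b ∸ toℕ (snoc p (suc k) y (suc (suc k))) ℕ.≤ f
        fuel′ rewrite snoc-last p (suc k) y = ℕ.≤-pred (ℕ.<-≤-trans (ℕ.∸-monoʳ-< x<y (ℕ.<⇒≤ y<b)) fuel)

      thick⇒good : ∃ Good
      thick⇒good with any? inner-neighbour?
      ... | no none = no-inner-neighbour⇒good λ y y-in a~y → none (y , y-in , a~y)
      ... | yes some with x , ((Ax , a<x , x<b) , a~x) , ≤x ← greatest _ inner-neighbour? some =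
        walk (toℕ b ∸ toℕ x) 1 start ℕ.≤-refl first-edge
        where
        start : ℕ → Fin n
        start 0 = a
        start (suc _) = x
        increasing : ∀ i j → i ℕ.< j → j ℕ.≤ 1 → start i < start j
        increasing 0 1 _ _ = a<x
        increasing 0 (suc (suc _)) _ (s≤s ())
        increasing (suc _) 1 (s≤s ()) _
        increasing (suc _) (suc (suc _)) _ (s≤s ())
        greedy₀ : ∀ y → Alive y → a ~ y → y < b → y ≤ x
        greedy₀ y Ay a~y y<b with <-cmp a y
        ... | tri< a<y _ _ = ≤x y ((Ay , a<y , y<b) , a~y)
        ... | tri≈ _ a≡y _ = ⊥-elim (~⇒≢ a~y a≡y)
        ... | tri> _ _ y<a = ℕ.<⇒≤ (<-trans y<a a<x)
        alive : ∀ i → i ℕ.≤ 1 → Alive (start i)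
        alive 0 _ = Aa
        alive 1 _ = Ax
        alive (suc (suc _)) (s≤s ())
        first-edge : GreedyPath 1 start
        first-edge = record
          { starts     = refl
          ; nonempty   = ℕ.≤-refl
          ; increasing = increasing
          ; steps      = λ { 0 _ → a~x ; (suc _) (s≤s ()) }
          ; greedy     = λ i i<1 1≤i → ⊥-elim (ℕ.<⇒≱ i<1 1≤i)
          ; greedy₀    = greedy₀
          ; alive      = alive
          ; below      = x<b
          }

    nested-thick? : ∀ (a b x y : Fin n) → Dec (a ≤ x × y ≤ b × (a < x ⊎ y < b) × AliveEdge x y × ¬ Thin x y)
    nested-thick? a b x y =
      a ≤? x ×-dec y ≤? b ×-dec (a <? x ⊎-dec y <? b) ×-dec aliveEdge? x y ×-dec ¬? (thin? x y)

    thick-edge⇒good : ∀ f a b → toℕ b ∸ toℕ a ℕ.≤ f → AliveEdge a b → ¬ Thin a b → ∃ Good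
    thick-edge⇒good 0 a b span (_ , _ , a<b , _) _ = ⊥-elim (ℕ.<⇒≱ (ℕ.m<n⇒0<n∸m a<b) span)
    thick-edge⇒good (suc f) a b span ab ¬thin with any? (λ x → any? (λ y → nested-thick? a b x y))
    ... | yes (x , y , a≤x , y≤b , nested , xy@(_ , _ , x<y , _) , ¬thin-xy) =
      thick-edge⇒good f x y (ℕ.≤-pred (ℕ.<-≤-trans (nested-span< a≤x y≤b nested x<y) span)) xy ¬thin-xy
    ... | no none = Innermost.thick⇒good ab ¬thin λ x y a≤x y≤b nested xy →
      decidable-stable (thin? x y) λ ¬thin-xy → none (x , y , a≤x , y≤b , nested , xy , ¬thin-xy)

    good-exists : ∀ {v} → Alive v → ∃ Good
    good-exists Av with any? (λ a → any? (λ b → aliveEdge? a b ×-dec ¬? (thin? a b)))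
    ... | yes (a , b , ab , ¬thin) = thick-edge⇒good _ a b ℕ.≤-refl ab ¬thin
    ... | no none = all-thin⇒good (λ a b ab → decidable-stable (thin? a b) λ ¬thin → none (a , b , ab , ¬thin)) Av

  open Alive using (Near; good-exists)

  -- Deleting a simplicial vertex x keeps distances ≤ 2 among the others: a path y x z shortcuts to the edge y z.
  peel : ∀ f A (S : Fin n → Bool) → count A (allFin n) ℕ.≤ f → (∀ u → S u ≡ true → A u ≡ true) →
         ∀ {v} → S v ≡ true → ∃ λ x → S x ≡ true × Σ (List (Fin n)) λ L → length L ℕ.≤ Δ ×
                                   (∀ y → S y ≡ true → Near A x y → y ∈ L)
  peel f A S |A|≤f S⊆A Sv with good-exists A (S⊆A _ Sv)
  ... | x , Ax , simplicial , L , |L|≤Δ , covers with S x ≟ᵇ true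
  ...   | yes Sx = x , Sx , L , |L|≤Δ , λ y Sy near → covers y (S⊆A y Sy) near
  ...   | no ¬Sx with f
  ...     | 0 = ⊥-elim (ℕ.<⇒≱ (ℕ.<-≤-trans (count-without< A Ax) |A|≤f) z≤n)
  ...     | suc f′ with peel f′ (without A x) S (ℕ.≤-pred (ℕ.<-≤-trans (count-without< A Ax) |A|≤f)) S⊆A∖x Sv
    where
    S⊆A∖x : ∀ u → S u ≡ true → without A x u ≡ true
    S⊆A∖x u Su = without⁺ A (S⊆A u Su) λ { refl → ¬Sx Su }
  ... | x′ , Sx′ , L′ , |L′|≤Δ , covers′ = x′ , Sx′ , L′ , |L′|≤Δ , λ y Sy near → covers′ y Sy (shortcut y Sy near)
    where
    shortcut : ∀ y → S y ≡ true → Near A x′ y → Near (without A x) x′ y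
    shortcut y Sy (x′≢y , inj₁ x′y) = x′≢y , inj₁ x′y
    shortcut y Sy (x′≢y , inj₂ (w , Aw , x′w , wy)) with w ≟ x
    ... | yes refl = x′≢y , inj₁ (simplicial x′ y (S⊆A x′ Sx′) (S⊆A y Sy) (~-sym x′w) wy x′≢y)
    ... | no w≢x = x′≢y , inj₂ (w , without⁺ A Aw w≢x , x′w , wy)

  square-degenerate : Degenerate (square G) Δ
  square-degenerate S Sv with x , Sx , L , |L|≤Δ , covers ← peel _ (λ _ → true) S ℕ.≤-refl (λ _ _ → refl) Sv =
    x , Sx , L , |L|≤Δ , λ {u} Su sq → covers u Su (near sq)
    where
    near : ∀ {u} → Adj (square G) x u → Near (λ _ → true) x u
    near sq with square⁻ G sq
    ... | x≢u , inj₁ xu = x≢u , inj₁ xu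
    ... | x≢u , inj₂ (w , xw , wu) = x≢u , inj₂ (w , refl , xw , wu)

injective⇒onto : ∀ {n} (σ : Fin n → Fin n) → Injective _≡_ _≡_ σ → ∀ v → ∃ λ i → σ i ≡ v
injective⇒onto {suc n} σ σ-injective v with any? (λ i → σ i ≟ v)
... | yes hit = hit
... | no miss = ⊥-elim (ℕ.<-irrefl refl (injective⇒≤ avoid-v-injective))
  where
  avoid-v : Fin (suc n) → Fin n
  avoid-v i = punchOut {i = v} {j = σ i} λ v≡σi → miss (i , sym v≡σi)
  avoid-v-injective : Injective _≡_ _≡_ avoid-v
  avoid-v-injective {i} {j} eq =
    σ-injective (punchOut-injective {i = v} (λ v≡σi → miss (i , sym v≡σi)) (λ v≡σj → miss (j , sym v≡σj)) eq)

relabel : ∀ {n} → SimpleGraph n → (Fin n → Fin n) → SimpleGraph n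
relabel G σ = record
  { E      = λ i j → E G (σ i) (σ j)
  ; sym    = λ i j → SimpleGraph.sym G (σ i) (σ j)
  ; irrefl = λ i → SimpleGraph.irrefl G (σ i)
  }

module _ {n : ℕ} (G : SimpleGraph n) (σ : Fin n → Fin n) (σ-injective : Injective _≡_ _≡_ σ) where

  relabel-chordal : Chordal G → Chordal (relabel G σ)
  relabel-chordal chordal m c (c-injective , c-steps) =
    chordal m (λ i → σ (c i)) ((λ σci≡σcj → c-injective (σ-injective σci≡σcj)) , c-steps)

  relabel-degreeBounded : ∀ {Δ} → DegreeBounded G Δ → DegreeBounded (relabel G σ) Δ
  relabel-degreeBounded {Δ} degree≤ {v} {L} !L adjacent =
    subst (ℕ._≤ Δ) (length-map σ L) (degree≤ (Unique.map⁺ σ-injective !L) σL-adjacent)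
    where
    σL-adjacent : ∀ {u} → u ∈ map σ L → Adj (E G) (σ v) u
    σL-adjacent u∈ with w , w∈L , refl ← ∈-map⁻ σ u∈ = adjacent w∈L

  relabel-square-degenerate : ∀ {Δ} → Degenerate (square (relabel G σ)) Δ → Degenerate (square G) Δ
  relabel-square-degenerate {Δ} degenerate S {v} Sv
    with j , refl ← injective⇒onto σ σ-injective v
    with x , Sx , L , |L|≤Δ , covers ← degenerate (λ i → S (σ i)) Sv =
    σ x , Sx , map σ L , subst (ℕ._≤ Δ) (sym (length-map σ L)) |L|≤Δ , σL-covers
    where
    σL-covers : ∀ {u} → S u ≡ true → Adj (square G) (σ x) u → u ∈ map σ L
    σL-covers {u} Su sq with y , refl ← injective⇒onto σ σ-injective u with square⁻ G sq
    ... | σx≢σy , inj₁ xy = ∈-map⁺ σ (covers Su (edge⇒square (relabel G σ) xy))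
    ... | σx≢σy , inj₂ (w , xw , wy) with w′ , refl ← injective⇒onto σ σ-injective w =
      ∈-map⁺ σ (covers Su (path⇒square (relabel G σ) w′ (λ x≡y → σx≢σy (cong σ x≡y)) xw wy))

maxDegree⇒degreeBounded : ∀ {n} {G : SimpleGraph n} {Δ} → (∀ v → deg (E G) v ℕ.≤ Δ) → DegreeBounded G Δ
maxDegree⇒degreeBounded {n} {G} deg≤Δ {v} !L adjacent =
  ℕ.≤-trans (length≤count (E G v) !L λ {u} u∈L → ∈-allFin u , adjacent u∈L) (deg≤Δ v)

module _ {n : ℕ} (G : SimpleGraph n) where

  square-degenerate : ∀ {Δ} → Δ ℕ.≤ 3 → Chordal G → Outerplanar G → (∀ v → deg (E G) v ℕ.≤ Δ) →
                      Degenerate (square G) Δ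
  square-degenerate {Δ} Δ≤3 chordal (σ , σ-injective , noncrossing) deg≤Δ =
    relabel-square-degenerate G σ σ-injective
      (OuterOrder.square-degenerate (relabel G σ) Δ Δ≤3
        (relabel-degreeBounded G σ σ-injective (maxDegree⇒degreeBounded {G = G} deg≤Δ))
        (λ {i} {j} {k} {l} → noncrossing i j k l)
        (relabel-chordal G σ σ-injective chordal))

  closedNeighbourhood : Fin n → List (Fin n)
  closedNeighbourhood v = v ∷ neighbours G v

  |closedNeighbourhood| : ∀ v → length (closedNeighbourhood v) ≡ suc (deg (E G) v)
  |closedNeighbourhood| v = cong suc (|neighbours| G v)

  closedNeighbourhood-unique : ∀ v → Unique (closedNeighbourhood v)
  closedNeighbourhood-unique v =
    All.tabulate (λ u∈ v≡u → Adj-irrefl G (subst (Adj (E G) v) (sym v≡u) (neighbours⁻ G u∈)))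
    ∷ neighbours-unique G v

  closedNeighbourhood-square : ∀ {v a b} → a ∈ closedNeighbourhood v → b ∈ closedNeighbourhood v → a ≢ b →
                               Adj (square G) a b
  closedNeighbourhood-square (here refl) (here refl) a≢b = ⊥-elim (a≢b refl)
  closedNeighbourhood-square (here refl) (there b∈) _ = edge⇒square G (neighbours⁻ G b∈)
  closedNeighbourhood-square (there a∈) (here refl) _ = edge⇒square G (Adj-sym G (neighbours⁻ G a∈))
  closedNeighbourhood-square {v} (there a∈) (there b∈) a≢b =
    path⇒square G v a≢b (Adj-sym G (neighbours⁻ G a∈)) (neighbours⁻ G b∈)

two-or-three⇒≤3 : ∀ {Δ} → Δ ≡ 2 ⊎ Δ ≡ 3 → Δ ℕ.≤ 3
two-or-three⇒≤3 (inj₁ refl) = ℕ.n≤1+n 2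
two-or-three⇒≤3 (inj₂ refl) = ℕ.≤-refl

theorem4p3 : (n : ℕ) (G : SimpleGraph n) (Δ : ℕ) →
    Chordal G → Outerplanar G → MaxDegreeIs (E G) Δ → (Δ ≡ 2 ⊎ Δ ≡ 3) →
    CliqueNumberIs (square G) (suc Δ) × ChromaticNumberIs (square G) (suc Δ) × InductivenessIs (square G) Δ
theorem4p3 n G Δ chordal outerplanar ((v , deg-v≡Δ) , deg≤Δ) Δ∈2,3 =
    (clique , λ _ _ other → clique≤colours other (proj₂ colouring))
  , (colouring , λ _ _ other → clique≤colours (proj₂ clique) other)
  , (subsetOf K , listClique-minDegree (square-irrefl G) !K K-square (here refl) |K|≡1+Δ)
  , (λ _ _ → degenerate⇒minDegree≤ degenerate)
  where
  degenerate : Degenerate (square G) Δ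
  degenerate = square-degenerate G (two-or-three⇒≤3 Δ∈2,3) chordal outerplanar deg≤Δ
  colouring : Σ _ (IsColouring (square G) (suc Δ))
  colouring = degenerate⇒colouring (square-sym G) (square-irrefl G) degenerate
  K : List (Fin n)
  K = closedNeighbourhood G v
  !K : Unique K
  !K = closedNeighbourhood-unique G v
  K-square : ∀ {a b} → a ∈ K → b ∈ K → a ≢ b → Adj (square G) a b
  K-square = closedNeighbourhood-square G
  |K|≡1+Δ : length K ≡ suc Δ
  |K|≡1+Δ = trans (|closedNeighbourhood| G v) (cong suc deg-v≡Δ)
  clique : Σ _ (IsClique (square G) (suc Δ))
  clique = subst (λ k → Σ _ (IsClique (square G) k)) |K|≡1+Δ (lookup K , listClique (square-irrefl G) !K K-square)
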